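{- For any nonnegative integer $k$, positive real number $\ell$ and positive integer $w$, there exists a positive real number $N$ such that if $m$ is a positive integer and $(G,\phi)$ is a $(0,\ell]$-bounded weighted graph such that $G$ has a $w$-vertex-cover of size at most $k$, then every $m$-coloring of $(G,\phi)^\ell$ has weak diameter in $(G,\phi)^\ell$ at most $N$.
   Context: All graphs are finite and simple. A weighted graph $(G,\phi)$ is $(0,\ell]$-bounded if $\phi(E(G))\subseteq(0,\ell]$; $d_{(G,\phi)}$ is the infimum of path lengths (sums of weights). $(G,\phi)^\ell$ is the graph on $V(G)$ with distinct $x,y$ adjacent iff $d_{(G,\phi)}(x,y)\le\ell$. A $w$-vertex-cover of $G$ is a set $S\subseteq V(G)$ such that every component of $G-S$ has at most $w$ vertices. An $m$-coloring of a graph $J$ is a map $V(J)\to[m]$; it has weak diameter in $J$ at most $d$ if every monochromatic component (component of the subgraph induced by a color class) has all pairwise distances in $J$ (edge count) at most $d$. -}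

module Defs where

open import Level using (0ℓ)
open import Data.Nat as ℕ using (ℕ; zero; suc)
open import Data.Fin using (Fin)
open import Data.Fin.Subset using (Subset; _∈_; _∉_; ∣_∣)
open import Data.List using (List; []; _∷_; length)
open import Data.List.Relation.Unary.All using (All)
open import Data.List.Relation.Unary.Unique.Propositional using (Unique)
open import Data.Product using (Σ; ∃; _×_; _,_)
open import Data.Sum using (_⊎_)
open import Relation.Nullary using (¬_)
open import Relation.Binary.PropositionalEquality using (_≡_; _≢_)
open import Algebra.Structures using (IsCommutativeRing)

-- The real numbers, axiomatised as a (Dedekind-)complete ordered field.
-- Any two such structures are isomorphic, so quantifying over all of
-- them is the same as speaking about ℝ.

record RealField : Set₁ where
  infixl 6 _+_
  infixl 7 _*_
  infix  4 _<_ _≤_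
  field
    Carrier : Set
    _+_ _*_ : Carrier → Carrier → Carrier
    -_      : Carrier → Carrier
    0# 1#   : Carrier
    _<_     : Carrier → Carrier → Set
    isCommutativeRing : IsCommutativeRing _≡_ _+_ _*_ -_ 0# 1#
    0≢1     : 0# ≢ 1#
    *-inv   : ∀ x → x ≢ 0# → ∃ λ y → x * y ≡ 1#
    <-irrefl : ∀ x → ¬ (x < x)
    <-trans  : ∀ {x y z} → x < y → y < z → x < z
    <-trich  : ∀ x y → x < y ⊎ (x ≡ y ⊎ y < x)
    +-mono-< : ∀ {x y} z → x < y → x + z < y + z
    *-pos    : ∀ {x y} → 0# < x → 0# < y → 0# < x * y

  _≤_ : Carrier → Carrier → Set
  x ≤ y = x < y ⊎ x ≡ y

  UpperBound : (Carrier → Set) → Carrier → Set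
  UpperBound P b = ∀ x → P x → x ≤ b

  field
    complete : (P : Carrier → Set) → ∃ P → ∃ (UpperBound P) →
               ∃ λ s → UpperBound P s × (∀ b → UpperBound P b → s ≤ b)

  fromℕ : ℕ → Carrier
  fromℕ zero    = 0#
  fromℕ (suc n) = 1# + fromℕ n

record Graph (n : ℕ) : Set₁ where
  field
    Adj     : Fin n → Fin n → Set
    irrefl  : ∀ {x} → ¬ Adj x x
    sym     : ∀ {x y} → Adj x y → Adj y x

data Walk {n : ℕ} (E : Fin n → Fin n → Set) : Fin n → Fin n → Set where
  [] : ∀ {x} → Walk E x x
  _∷_ : ∀ {x y z} → E x y → Walk E y z → Walk E x z

module _ {n : ℕ} {E : Fin n → Fin n → Set} where

  vertices : ∀ {x y} → Walk E x y → List (Fin n)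
  vertices {x} []       = x ∷ []
  vertices {x} (e ∷ p)  = x ∷ vertices p

  edgeCount : ∀ {x y} → Walk E x y → ℕ
  edgeCount []      = 0
  edgeCount (e ∷ p) = suc (edgeCount p)

  IsPath : ∀ {x y} → Walk E x y → Set
  IsPath p = Unique (vertices p)

  -- x and y are joined by a walk all of whose vertices satisfy P
  -- (i.e. they lie in the same component of the subgraph induced by P)
  ConnIn : (Fin n → Set) → Fin n → Fin n → Set
  ConnIn P x y = Σ (Walk E x y) λ p → All P (vertices p)

ComponentsAtMost : ∀ {n} → (Fin n → Fin n → Set) → (Fin n → Set) → ℕ → Set
ComponentsAtMost {n} E P w =
  ∀ x → P x → (L : List (Fin n)) → Unique L → All (ConnIn {E = E} P x) L →
  length L ℕ.≤ w

IsVertexCover : ∀ {n} → Graph n → ℕ → Subset n → Set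
IsVertexCover G w S = ComponentsAtMost (Graph.Adj G) (λ v → v ∉ S) w

module Weighted (ℝ : RealField) where
  open RealField ℝ

  -- φ is given on all ordered pairs, symmetric; only edge values matter
  record WeightedGraph (n : ℕ) : Set₁ where
    field
      graph : Graph n
      φ     : Fin n → Fin n → Carrier
      φ-sym : ∀ x y → φ x y ≡ φ y x
    open Graph graph public

  module _ {n : ℕ} (Gφ : WeightedGraph n) where
    open WeightedGraph Gφ

    Bounded : Carrier → Set
    Bounded ℓ = ∀ x y → Adj x y → (0# < φ x y) × (φ x y ≤ ℓ)

    weight : ∀ {x y} → Walk Adj x y → Carrier
    weight []            = 0#
    weight (_∷_ {x} {y} e p) = φ x y + weight p

    -- d_(G,φ)(x,y) ≤ r, where d is the infimum of lengths of paths
    -- from x to y (+∞ if none): for every ε > 0 some path has length < r + ε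
    DistLe : Fin n → Fin n → Carrier → Set
    DistLe x y r = ∀ ε → 0# < ε →
      Σ (Walk Adj x y) λ p → IsPath p × (weight p < r + ε)

    PowerAdj : Carrier → Fin n → Fin n → Set
    PowerAdj ℓ x y = x ≢ y × DistLe x y ℓ

  GraphDistLe : ∀ {n} → (Fin n → Fin n → Set) → Fin n → Fin n → Carrier → Set
  GraphDistLe E x y N = Σ (Walk E x y) λ q → fromℕ (edgeCount q) ≤ N

  WeakDiamLe : ∀ {n m} → (Fin n → Fin n → Set) → (Fin n → Fin m) → Carrier → Set
  WeakDiamLe {n} E c N = ∀ x y →
    ConnIn {E = E} (λ v → c v ≡ c x) x y → GraphDistLe E x y N

{-# OPTIONS --safe #-}
-- A monochromatic component of (G,φ)^ℓ is connected in (G,φ)^ℓ, hence x and y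
-- are joined by a path of G.  Since G - S has components of size at most w,
-- such a path consists of at most |S| ≤ k cover vertices separated by at most
-- k + 1 runs of at most w non-cover vertices, so it has at most k(w+1) + w
-- vertices.  Every edge of G is an edge of (G,φ)^ℓ, so this path witnesses
-- the distance bound N = k(w+1) + w, independently of the colouring.
module Submission where

open import Defs
open import Data.Nat as ℕ using (ℕ; suc; _+_; _*_; _≤_; z≤n; s≤s)
import Data.Nat.Properties as ℕ
open import Data.Fin using (Fin)
open import Data.Fin.Properties using (_≟_)
open import Data.Fin.Subset using (Subset; ∣_∣; _∈_; _∉_; _-_)
open import Data.Fin.Subset.Properties using (_∈?_; x∈p∧x≢y⇒x∈p-y; x∈p⇒∣p-x∣<∣p∣)
open import Data.Bool using (true; false)
open import Data.List using (List; []; _∷_; length; filter; takeWhile)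
open import Data.List.Relation.Unary.All as All using (All; []; _∷_)
import Data.List.Relation.Unary.All.Properties as All
open import Data.List.Relation.Unary.AllPairs using ([]; _∷_)
open import Data.List.Relation.Unary.Any using (here; there)
open import Data.List.Relation.Unary.Unique.Propositional using (Unique)
import Data.List.Relation.Unary.Unique.Propositional.Properties as Unique
open import Data.List.Membership.Propositional using () renaming (_∈_ to _∈ˡ_)
open import Data.List.Membership.DecPropositional using () renaming (_∈?_ to ∈ˡ?)
open import Data.Product using (Σ; ∃; _×_; _,_; proj₁; proj₂)
open import Data.Sum using (inj₁; inj₂)
open import Data.Empty using (⊥-elim)
open import Relation.Nullary using (Dec; yes; no; does; ¬?)
open import Data.List.Relation.Unary.All.Properties.Core using (¬Any⇒All¬)
open import Relation.Unary using (Pred; Decidable)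
open import Relation.Binary.PropositionalEquality
  using (_≡_; _≢_; refl; sym; cong; subst; subst₂; module ≡-Reasoning)
open import Algebra.Bundles using (Ring)

module _ {A : Set} {p} {P : Pred A p} (P? : Decidable P) where

  Unique-takeWhile : ∀ {xs} → Unique xs → Unique (takeWhile P? xs)
  Unique-takeWhile {[]}     []           = []
  Unique-takeWhile {x ∷ xs} (x∉xs ∷ xs!) with does (P? x)
  ... | true  = All.takeWhile⁺ P? x∉xs ∷ Unique-takeWhile xs!
  ... | false = []

Unique⇒length≤∣∣ : ∀ {n} (S : Subset n) {xs : List (Fin n)} →
                   Unique xs → All (_∈ S) xs → length xs ≤ ∣ S ∣
Unique⇒length≤∣∣ S []           []           = z≤n
Unique⇒length≤∣∣ S {x ∷ xs} (x≢xs ∷ xs!) (x∈S ∷ xs⊆S) =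
  ℕ.<-≤-trans (s≤s (Unique⇒length≤∣∣ (S - x) xs! xs⊆S-x)) (x∈p⇒∣p-x∣<∣p∣ x∈S)
  where
  xs⊆S-x : All (_∈ S - x) xs
  xs⊆S-x = All.zipWith (λ (y∈S , x≢y) → x∈p∧x≢y⇒x∈p-y y∈S (λ y≡x → x≢y (sym y≡x)))
                       (xs⊆S , x≢xs)

_∉?_ : ∀ {n} (x : Fin n) (S : Subset n) → Dec (x ∉ S)
x ∉? S = ¬? (x ∈? S)

module _ {n : ℕ} where

  infixr 5 _++ʷ_

  _++ʷ_ : ∀ {E : Fin n → Fin n → Set} {x y z} → Walk E x y → Walk E y z → Walk E x z
  []      ++ʷ q = q
  (e ∷ p) ++ʷ q = e ∷ (p ++ʷ q)

  module _ {E F : Fin n → Fin n → Set} where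

    mapʷ : (∀ {a b} → E a b → F a b) → ∀ {x y} → Walk E x y → Walk F x y
    mapʷ f []      = []
    mapʷ f (e ∷ p) = f e ∷ mapʷ f p

    edgeCount-mapʷ : (f : ∀ {a b} → E a b → F a b) → ∀ {x y} (p : Walk E x y) →
                     edgeCount (mapʷ f p) ≡ edgeCount p
    edgeCount-mapʷ f []      = refl
    edgeCount-mapʷ f (e ∷ p) = cong suc (edgeCount-mapʷ f p)

    concatMapʷ : (∀ {a b} → E a b → Walk F a b) → ∀ {x y} → Walk E x y → Walk F x y
    concatMapʷ f []      = []
    concatMapʷ f (e ∷ p) = f e ++ʷ concatMapʷ f p

  module _ {E : Fin n → Fin n → Set} where

    length-vertices : ∀ {x y} (p : Walk E x y) → length (vertices p) ≡ suc (edgeCount p)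
    length-vertices []      = refl
    length-vertices (e ∷ p) = cong suc (length-vertices p)

    ConnIn⇒source : ∀ {P : Fin n → Set} {x y} → ConnIn {E = E} P x y → P x
    ConnIn⇒source ([]    , Px ∷ _) = Px
    ConnIn⇒source (_ ∷ _ , Px ∷ _) = Px

    dropUntil : ∀ {x z y} (p : Walk E z y) → x ∈ˡ vertices p → IsPath p →
                Σ (Walk E x y) IsPath
    dropUntil []      (here refl) p! = [] , p!
    dropUntil (e ∷ p) (here refl) p! = e ∷ p , p!
    dropUntil (e ∷ p) (there x∈p) (_ ∷ p!) = dropUntil p x∈p p!

    toPath : ∀ {x y} → Walk E x y → Σ (Walk E x y) IsPath
    toPath []          = [] , [] ∷ []
    toPath {x} (e ∷ p) with toPath p
    ... | q , q! with ∈ˡ? _≟_ x (vertices q)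
    ...   | yes x∈q = dropUntil q x∈q q!
    ...   | no  x∉q = e ∷ q , ¬Any⇒All¬ (vertices q) x∉q ∷ q!

module CoverBound {n : ℕ} (G : Graph n) {S : Subset n} {w : ℕ}
                  (cov : IsVertexCover G w S) where
  open Graph G using (Adj)

  run : List (Fin n) → List (Fin n)
  run = takeWhile (_∉? S)

  hits : List (Fin n) → ℕ
  hits xs = length (filter (_∈? S) xs)

  run-connected : ∀ {x y} (p : Walk Adj x y) →
                  All (ConnIn {E = Adj} (_∉ S) x) (run (vertices p))
  run-connected {x} [] with x ∈? S
  ... | yes _   = []
  ... | no  x∉S = ([] , x∉S ∷ []) ∷ []
  run-connected {x} (e ∷ p) with x ∈? S
  ... | yes _   = []
  ... | no  x∉S = ([] , x∉S ∷ []) ∷ All.map (λ (q , q∉S) → e ∷ q , x∉S ∷ q∉S) (run-connected p)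

  length-run≤ : ∀ {x y} (p : Walk Adj x y) → IsPath p → length (run (vertices p)) ≤ w
  length-run≤ {x} p p! with run (vertices p) | run-connected p | Unique-takeWhile (_∉? S) p!
  ... | []     | _             | _    = z≤n
  ... | v ∷ vs | conn@(Cv ∷ _) | run! = cov x (ConnIn⇒source Cv) (v ∷ vs) run! conn

  -- Each cover vertex accounts for itself and the run of at most w vertices after it.
  length-vertices≤ : ∀ {x y} (p : Walk Adj x y) → IsPath p →
                     length (vertices p) ≤ hits (vertices p) * suc w + length (run (vertices p))
  length-vertices≤ {x} [] _ with x ∈? S
  ... | yes _ = s≤s z≤n
  ... | no  _ = s≤s z≤n
  length-vertices≤ {x} (e ∷ p) (_ ∷ p!) with x ∈? S
  ... | yes _ = begin
    suc (length (vertices p))                   ≤⟨ s≤s (length-vertices≤ p p!) ⟩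
    suc (h * suc w + length (run (vertices p))) ≤⟨ s≤s (ℕ.+-monoʳ-≤ (h * suc w) (length-run≤ p p!)) ⟩
    suc (h * suc w + w)                         ≡⟨ cong suc (ℕ.+-comm (h * suc w) w) ⟩
    suc h * suc w                               ≡⟨ ℕ.+-identityʳ (suc h * suc w) ⟨
    suc h * suc w + 0                           ∎
    where
    open ℕ.≤-Reasoning
    h : ℕ
    h = hits (vertices p)
  ... | no  _ = subst (suc (length (vertices p)) ≤_)
                      (sym (ℕ.+-suc (hits (vertices p) * suc w) _))
                      (s≤s (length-vertices≤ p p!))

  length-path≤ : ∀ {k} → ∣ S ∣ ≤ k → ∀ {x y} (p : Walk Adj x y) → IsPath p →
                 length (vertices p) ≤ k * suc w + w
  length-path≤ ∣S∣≤k p p! = ℕ.≤-trans (length-vertices≤ p p!)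
    (ℕ.+-mono-≤ (ℕ.*-monoˡ-≤ (suc w) (ℕ.≤-trans hits≤∣S∣ ∣S∣≤k)) (length-run≤ p p!))
    where
    hits≤∣S∣ : hits (vertices p) ≤ ∣ S ∣
    hits≤∣S∣ = Unique⇒length≤∣∣ S (Unique.filter⁺ (_∈? S) p!) (All.all-filter (_∈? S) (vertices p))

module OrderedField (ℝ : RealField) where
  open RealField ℝ renaming (_+_ to _+ℝ_; _*_ to _*ℝ_; _≤_ to _≤ℝ_)
  open import Algebra.Structures using (IsCommutativeRing)
  open IsCommutativeRing isCommutativeRing
    using (isRing; +-identityˡ; +-comm; -‿inverseʳ; *-identityˡ)

  ring : Ring _ _
  ring = record { isRing = isRing }

  open import Algebra.Properties.Ring ring using (-‿distribˡ-*; -‿involutive)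

  0<1 : 0# < 1#
  0<1 with <-trich 0# 1#
  ... | inj₁ 0<1       = 0<1
  ... | inj₂ (inj₁ 0≡1) = ⊥-elim (0≢1 0≡1)
  ... | inj₂ (inj₂ 1<0) =
    ⊥-elim (<-irrefl 0# (<-trans (subst (0# <_) [-1]*[-1]≡1 0<[-1]*[-1]) 1<0))
    where
    0<-1 : 0# < - 1#
    0<-1 = subst₂ _<_ (-‿inverseʳ 1#) (+-identityˡ (- 1#)) (+-mono-< (- 1#) 1<0)
    [-1]*[-1]≡1 : - 1# *ℝ - 1# ≡ 1#
    [-1]*[-1]≡1 = begin
      - 1# *ℝ - 1#   ≡⟨ -‿distribˡ-* 1# (- 1#) ⟨
      - (1# *ℝ - 1#) ≡⟨ cong -_ (*-identityˡ (- 1#)) ⟩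
      - - 1#         ≡⟨ -‿involutive 1# ⟩
      1#             ∎
      where open ≡-Reasoning
    0<[-1]*[-1] : 0# < - 1# *ℝ - 1#
    0<[-1]*[-1] = *-pos 0<-1 0<-1

  x<x+y : ∀ x {y} → 0# < y → x < x +ℝ y
  x<x+y x {y} 0<y = subst₂ _<_ (+-identityˡ x) (+-comm y x) (+-mono-< x 0<y)

  ≤-<-trans : ∀ {x y z} → x ≤ℝ y → y < z → x < z
  ≤-<-trans (inj₁ x<y)  y<z = <-trans x<y y<z
  ≤-<-trans (inj₂ refl) y<z = y<z

  fromℕ<fromℕ-suc : ∀ j → fromℕ j < fromℕ (suc j)
  fromℕ<fromℕ-suc j = subst (fromℕ j <_) (+-comm (fromℕ j) 1#) (x<x+y (fromℕ j) 0<1)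

  fromℕ-mono-< : ∀ {i j} → i ℕ.< j → fromℕ i < fromℕ j
  fromℕ-mono-< {i} {suc j} i<1+j with ℕ.m<1+n⇒m<n∨m≡n i<1+j
  ... | inj₁ i<j  = <-trans (fromℕ-mono-< i<j) (fromℕ<fromℕ-suc j)
  ... | inj₂ refl = fromℕ<fromℕ-suc j

  fromℕ-mono-≤ : ∀ {i j} → i ≤ j → fromℕ i ≤ℝ fromℕ j
  fromℕ-mono-≤ i≤j with ℕ.m≤n⇒m<n∨m≡n i≤j
  ... | inj₁ i<j  = inj₁ (fromℕ-mono-< i<j)
  ... | inj₂ refl = inj₂ refl

module PowerGraph (ℝ : RealField) {n : ℕ} (Gφ : Weighted.WeightedGraph ℝ n)
                  {ℓ : RealField.Carrier ℝ} (0<ℓ : RealField._<_ ℝ (RealField.0# ℝ) ℓ) where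
  open RealField ℝ using (_<_; fromℕ) renaming (_+_ to _+ℝ_)
  open import Algebra.Structures using (IsCommutativeRing)
  open IsCommutativeRing (RealField.isCommutativeRing ℝ) using (+-identityʳ)
  open OrderedField ℝ
  open Weighted ℝ
  open WeightedGraph Gφ using (graph; φ; Adj; irrefl)

  PowerAdj⇒Walk : ∀ {a b} → PowerAdj Gφ ℓ a b → Walk Adj a b
  PowerAdj⇒Walk (_ , d≤ℓ) = proj₁ (d≤ℓ ℓ 0<ℓ)

  Adj⇒PowerAdj : Bounded Gφ ℓ → ∀ {a b} → Adj a b → PowerAdj Gφ ℓ a b
  Adj⇒PowerAdj bounded {a} {b} ab = a≢b , λ ε 0<ε →
    ab ∷ [] , (a≢b ∷ []) ∷ [] ∷ [] ,
    subst (_< ℓ +ℝ ε) (sym (+-identityʳ (φ a b)))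
          (≤-<-trans (proj₂ (bounded a b ab)) (x<x+y ℓ 0<ε))
    where
    a≢b : a ≢ b
    a≢b refl = irrefl ab

  powerWalk⇒distance≤ : Bounded Gφ ℓ → ∀ {k w} {S : Subset n} → ∣ S ∣ ≤ k →
    IsVertexCover graph w S → ∀ {x y} → Walk (PowerAdj Gφ ℓ) x y →
    GraphDistLe (PowerAdj Gφ ℓ) x y (fromℕ (k * suc w + w))
  powerWalk⇒distance≤ bounded {k} {w} ∣S∣≤k cov pw with toPath (concatMapʷ PowerAdj⇒Walk pw)
  ... | p , p! = mapʷ (Adj⇒PowerAdj bounded) p , fromℕ-mono-≤ (begin
    edgeCount (mapʷ (Adj⇒PowerAdj bounded) p) ≡⟨ edgeCount-mapʷ (Adj⇒PowerAdj bounded) p ⟩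
    edgeCount p                               ≤⟨ ℕ.n≤1+n (edgeCount p) ⟩
    suc (edgeCount p)                         ≡⟨ length-vertices p ⟨
    length (vertices p)                       ≤⟨ CoverBound.length-path≤ graph cov ∣S∣≤k p p! ⟩
    k * suc w + w                             ∎)
    where open ℕ.≤-Reasoning

open RealField using (Carrier; 0#; _<_)
open Weighted using (WeightedGraph; Bounded; PowerAdj; WeakDiamLe)

lemma3p5 : (ℝ : RealField) (k : ℕ) (ℓ : Carrier ℝ) → _<_ ℝ (0# ℝ) ℓ →
    (w : ℕ) → 1 ℕ.≤ w →
    ∃ λ (N : Carrier ℝ) → _<_ ℝ (0# ℝ) N ×
      ((m : ℕ) → 1 ℕ.≤ m → (n : ℕ) (Gφ : WeightedGraph ℝ n) → Bounded ℝ Gφ ℓ →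
       (∃ λ (S : Subset n) → ∣ S ∣ ℕ.≤ k × IsVertexCover (WeightedGraph.graph Gφ) w S) →
       (c : Fin n → Fin m) → WeakDiamLe ℝ (PowerAdj ℝ Gφ ℓ) c N)
lemma3p5 ℝ k ℓ 0<ℓ w 1≤w =
  RealField.fromℕ ℝ (k * suc w + w) ,
  OrderedField.fromℕ-mono-< ℝ (ℕ.<-≤-trans 1≤w (ℕ.m≤n+m w (k * suc w))) ,
  λ m _ n Gφ bounded (S , ∣S∣≤k , cov) c x y (pw , _) →
    PowerGraph.powerWalk⇒distance≤ ℝ Gφ 0<ℓ bounded ∣S∣≤k cov pw
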